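{- Let $n,k\in\mathbb{N}$ with $n\ge k$, and let $x$ be an integer with $k\le x\le n$. Then $F_n(x,k)>0$ if and only if $$\begin{cases} x+\left\lfloor \frac{x}{k}\right\rfloor\le n & \text{if } k\nmid x,\\[2pt] x+\frac{x}{k}-1\le n & \text{if } k\mid x.\end{cases}$$
   Context: For integers $n,x,k\ge 0$, $B_n^{x,k}$ denotes the set of binary strings of length $n$ that contain exactly $x$ zeros and in which the longest block of consecutive zeros (maximal subword consisting only of zeros) has length exactly $k$. $F_n(x,k)=|B_n^{x,k}|$. $\lfloor y\rfloor$ is the largest integer $\le y$. -}

module Defs where

open import Data.Nat using (ℕ; zero; suc; _+_; _⊔_)
open import Data.Bool using (Bool; true; false)
open import Data.Vec using (Vec; []; _∷_)
open import Data.Product using (∃; _×_)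
open import Relation.Binary.PropositionalEquality using (_≡_)

-- Binary strings of length n: Vec Bool n, with false = the letter 0 and true = the letter 1.

zeros : {n : ℕ} → Vec Bool n → ℕ
zeros []          = 0
zeros (false ∷ w) = suc (zeros w)
zeros (true  ∷ w) = zeros w

leadingZeros : {n : ℕ} → Vec Bool n → ℕ
leadingZeros []          = 0
leadingZeros (false ∷ w) = suc (leadingZeros w)
leadingZeros (true  ∷ w) = 0

longestZeroRun : {n : ℕ} → Vec Bool n → ℕ
longestZeroRun []      = 0
longestZeroRun (b ∷ w) = leadingZeros (b ∷ w) ⊔ longestZeroRun w

InB : (n x k : ℕ) → Vec Bool n → Set
InB n x k w = zeros w ≡ x × longestZeroRun w ≡ k

FPositive : (n x k : ℕ) → Set
FPositive n x k = ∃ λ (w : Vec Bool n) → InB n x k w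

module Submission where

open import Defs
open import Data.Nat using (ℕ; _+_; _∸_; _≤_; NonZero)
open import Data.Nat.DivMod using (_/_)
open import Data.Nat.Divisibility using (_∣_)
open import Relation.Nullary using (¬_)
open import Function.Bundles using (_⇔_)
open import Data.Product using (_×_)

open import Data.Nat using (zero; suc; _*_; _<_; z≤n; s≤s)
open import Data.Nat.Properties
open import Data.Nat.DivMod using (_%_; m≡m%n+[m/n]*n; m%n<n; m/n*n≡m)
open import Data.Nat.Divisibility using (_∣?_; m%n≡0⇒n∣m)
open import Data.Bool using (Bool; true; false)
open import Data.Vec using (Vec; []; _∷_)
open import Data.Product using (_,_)
open import Relation.Nullary using (Dec; yes; no)
open import Relation.Binary.PropositionalEquality
  using (_≡_; refl; sym; trans; cong; subst)
open import Function.Bundles using (mk⇔; Equivalence)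
open import Function.Properties.Equivalence using () renaming (trans to ⇔-trans; sym to ⇔-sym)

-- Write n = x + m, so a string in B_n^{x,k} has exactly m ones.
-- The m ones cut the string into m + 1 (possibly empty) blocks of zeros, each
-- of length at most the longest run; hence x ≤ (m + 1) k is necessary.
-- Conversely, if x ≤ (m + 1) k and k ≤ x, the greedy string that writes
-- blocks of k zeros separated by single ones (padding with ones at the end)
-- has x zeros and longest run exactly k.  So
--
--     F_{x+m}(x,k) > 0   ⇔   x ≤ (m + 1) k                  (capacity)
--
-- and the theorem is an arithmetic reformulation of the right-hand side in
-- terms of q = ⌊x/k⌋: it says q ≤ m when k ∤ x and q ≤ m + 1 when k ∣ x.

ones : {n : ℕ} → Vec Bool n → ℕ
ones []          = 0
ones (false ∷ w) = ones w
ones (true  ∷ w) = suc (ones w)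

zeros+ones≡length : ∀ {n} (w : Vec Bool n) → zeros w + ones w ≡ n
zeros+ones≡length []          = refl
zeros+ones≡length (false ∷ w) = cong suc (zeros+ones≡length w)
zeros+ones≡length (true  ∷ w) =
  trans (+-suc (zeros w) (ones w)) (cong suc (zeros+ones≡length w))

leadingZeros≤longestZeroRun : ∀ {n} (w : Vec Bool n) → leadingZeros w ≤ longestZeroRun w
leadingZeros≤longestZeroRun []      = z≤n
leadingZeros≤longestZeroRun (b ∷ w) = m≤m⊔n (leadingZeros (b ∷ w)) (longestZeroRun w)

-- Block decomposition: the zeros are the initial block plus one block after
-- each one; if all runs are bounded by L, the non-initial blocks contribute
-- at most L each.
zeros≤leading+ones*bound : ∀ {n} (w : Vec Bool n) L → longestZeroRun w ≤ L →
                           zeros w ≤ leadingZeros w + ones w * L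
zeros≤leading+ones*bound []          L _ = z≤n
zeros≤leading+ones*bound (false ∷ w) L runs≤L =
  s≤s (zeros≤leading+ones*bound w L (≤-trans (m≤n⊔m _ (longestZeroRun w)) runs≤L))
zeros≤leading+ones*bound (true ∷ w)  L runs≤L = begin
  zeros w                         ≤⟨ zeros≤leading+ones*bound w L tail≤L ⟩
  leadingZeros w + ones w * L     ≤⟨ +-monoˡ-≤ (ones w * L)
                                       (≤-trans (leadingZeros≤longestZeroRun w) tail≤L) ⟩
  L + ones w * L                  ∎
  where
  open ≤-Reasoning
  tail≤L : longestZeroRun w ≤ L
  tail≤L = ≤-trans (m≤n⊔m 0 (longestZeroRun w)) runs≤L

zeros≤blocks*bound : ∀ {n} (w : Vec Bool n) L → longestZeroRun w ≤ L →
                     zeros w ≤ suc (ones w) * L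
zeros≤blocks*bound w L runs≤L =
  ≤-trans (zeros≤leading+ones*bound w L runs≤L)
          (+-monoˡ-≤ (ones w * L) (≤-trans (leadingZeros≤longestZeroRun w) runs≤L))

module Greedy (k : ℕ) where

  -- greedy c n z: a string of length n placing z zeros, where c zeros may
  -- still be added to the current block; a full block is closed by a one,
  -- and once all zeros are placed the string is padded with ones.
  greedy : (c n z : ℕ) → Vec Bool n
  greedy c       zero    z       = []
  greedy c       (suc n) zero    = true  ∷ greedy c n zero
  greedy (suc c) (suc n) (suc z) = false ∷ greedy c n z
  greedy zero    (suc n) (suc z) = true  ∷ greedy k n (suc z)

  zeros-padding : ∀ c o → zeros (greedy c o 0) ≡ 0
  zeros-padding c zero    = refl
  zeros-padding c (suc o) = zeros-padding c o

  -- with o ones available, all z zeros get placed as long as they fit into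
  -- the current block (c) plus one full block after each one (o k)
  zeros-greedy : ∀ c z o → z ≤ c + o * k → zeros (greedy c (z + o) z) ≡ z
  zeros-greedy c       zero    o       _             = zeros-padding c o
  zeros-greedy (suc c) (suc z) o       (s≤s fits)    = cong suc (zeros-greedy c z o fits)
  zeros-greedy zero    (suc z) (suc o) fits
    rewrite +-suc z o                                = zeros-greedy k (suc z) o fits

  runs-greedy : ∀ c n z → c ≤ k →
                leadingZeros (greedy c n z) ≤ c × longestZeroRun (greedy c n z) ≤ k
  runs-greedy c       zero    z       _   = z≤n , z≤n
  runs-greedy (suc c) (suc n) (suc z) c≤k =
    let lead≤c , runs≤k = runs-greedy c n z (≤-trans (n≤1+n c) c≤k)
    in s≤s lead≤c , ⊔-lub (≤-trans (s≤s lead≤c) c≤k) runs≤k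
  runs-greedy zero    (suc n) (suc z) c≤k =
    let _ , runs≤k = runs-greedy k n (suc z) ≤-refl in z≤n , ⊔-lub z≤n runs≤k
  runs-greedy zero    (suc n) zero    c≤k =
    let _ , runs≤k = runs-greedy zero n zero c≤k in z≤n , ⊔-lub z≤n runs≤k
  runs-greedy (suc c) (suc n) zero    c≤k =
    let _ , runs≤k = runs-greedy (suc c) n zero c≤k in z≤n , ⊔-lub z≤n runs≤k

  leadingZeros-greedy : ∀ c n z → c ≤ z → z ≤ n → c ≤ leadingZeros (greedy c n z)
  leadingZeros-greedy zero    n       z       _         _         = z≤n
  leadingZeros-greedy (suc c) (suc n) (suc z) (s≤s c≤z) (s≤s z≤len) =
    s≤s (leadingZeros-greedy c n z c≤z z≤len)

capacity : ∀ x m k → k ≤ x → FPositive (x + m) x k ⇔ x ≤ suc m * k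
capacity x m k k≤x = mk⇔ necessary sufficient
  where
  open Greedy k

  necessary : FPositive (x + m) x k → x ≤ suc m * k
  necessary (w , zeros≡x , runs≡k) =
    subst (λ o → x ≤ suc o * k) ones≡m
      (subst (_≤ suc (ones w) * k) zeros≡x (zeros≤blocks*bound w k (≤-reflexive runs≡k)))
    where
    ones≡m : ones w ≡ m
    ones≡m = +-cancelˡ-≡ x (ones w) m
      (trans (cong (_+ ones w) (sym zeros≡x)) (zeros+ones≡length w))

  sufficient : x ≤ suc m * k → FPositive (x + m) x k
  sufficient fits = w , zeros-greedy k x m fits , ≤-antisym runs≤k k≤runs
    where
    w : Vec Bool (x + m)
    w = greedy k (x + m) x
    runs≤k : longestZeroRun w ≤ k
    runs≤k = let _ , runs≤k = runs-greedy k (x + m) x ≤-refl in runs≤k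
    k≤runs : k ≤ longestZeroRun w
    k≤runs = ≤-trans (leadingZeros-greedy k (x + m) x k≤x (m≤m+n x m))
                     (leadingZeros≤longestZeroRun w)

remainder-capacity : ∀ r q m k → 0 < r → r ≤ k → r + q * k ≤ suc m * k ⇔ q ≤ m
remainder-capacity r q m k 0<r r≤k = mk⇔ fits⇒q≤m (λ q≤m → +-mono-≤ r≤k (*-monoˡ-≤ k q≤m))
  where
  fits⇒q≤m : r + q * k ≤ suc m * k → q ≤ m
  fits⇒q≤m fits = ≮⇒≥ λ m<q → <⇒≱ (+-mono-<-≤ 0<r (*-monoˡ-≤ k m<q)) fits

multiple-capacity : ∀ q c k .{{_ : NonZero k}} → q * k ≤ c * k ⇔ q ≤ c
multiple-capacity q c k = mk⇔ (*-cancelʳ-≤ q c k) (*-monoˡ-≤ k)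

+-cancelˡ-⇔ : ∀ x q m → x + q ≤ x + m ⇔ q ≤ m
+-cancelˡ-⇔ x q m = mk⇔ (+-cancelˡ-≤ x q m) (+-monoʳ-≤ x)

pred≤⇔≤suc : ∀ a b → a ∸ 1 ≤ b ⇔ a ≤ suc b
pred≤⇔≤suc a b = mk⇔ (pred≤⇒≤suc a) (m≤n+o⇒m∸n≤o a 1)
  where
  pred≤⇒≤suc : ∀ a → a ∸ 1 ≤ b → a ≤ suc b
  pred≤⇒≤suc zero    _ = z≤n
  pred≤⇒≤suc (suc a) a≤b = s≤s a≤b

-- If k ∤ x then x = r + ⌊x/k⌋ k with 0 < r < k, and the capacity condition
-- becomes x + ⌊x/k⌋ ≤ x + m.
capacity-nondivisible : ∀ x m k .{{_ : NonZero k}} → ¬ (k ∣ x) →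
                        x ≤ suc m * k ⇔ x + x / k ≤ x + m
capacity-nondivisible x m k k∤x =
  ⇔-trans (subst (λ y → y ≤ suc m * k ⇔ x / k ≤ m) (sym (m≡m%n+[m/n]*n x k))
             (remainder-capacity (x % k) (x / k) m k 0<r (<⇒≤ (m%n<n x k))))
          (⇔-sym (+-cancelˡ-⇔ x (x / k) m))
  where
  0<r : 0 < x % k
  0<r = n≢0⇒n>0 (λ r≡0 → k∤x (m%n≡0⇒n∣m x k r≡0))

-- If k ∣ x then x = ⌊x/k⌋ k, and the capacity condition becomes
-- ⌊x/k⌋ ≤ m + 1, i.e. (x + ⌊x/k⌋) ∸ 1 ≤ x + m.
capacity-divisible : ∀ x m k .{{_ : NonZero k}} → k ∣ x →
                     x ≤ suc m * k ⇔ (x + x / k) ∸ 1 ≤ x + m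
capacity-divisible x m k k∣x =
  ⇔-trans (subst (λ y → y ≤ suc m * k ⇔ x / k ≤ suc m) (m/n*n≡m k∣x)
             (multiple-capacity (x / k) (suc m) k))
  (⇔-sym (⇔-trans (pred≤⇔≤suc (x + x / k) (x + m))
           (subst (λ b → x + x / k ≤ b ⇔ x / k ≤ suc m) (+-suc x m)
             (+-cancelˡ-⇔ x (x / k) (suc m)))))

case-equivalence : ∀ {A B C P : Set} → Dec P → (¬ P → A ⇔ B) → (P → A ⇔ C) →
                   A ⇔ ((¬ P → B) × (P → C))
case-equivalence {A} {B} {C} {P} P? A⇔B A⇔C = mk⇔ split (merge P?)
  where
  open Equivalence
  split : A → (¬ P → B) × (P → C)
  split a = (λ ¬p → to (A⇔B ¬p) a) , (λ p → to (A⇔C p) a)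
  merge : Dec P → (¬ P → B) × (P → C) → A
  merge (yes p) (_ , c) = from (A⇔C p) (c p)
  merge (no ¬p) (b , _) = from (A⇔B ¬p) (b ¬p)

lemma2p1 : (n x k : ℕ) → .{{_ : NonZero k}} → k ≤ n → k ≤ x → x ≤ n →
    FPositive n x k ⇔ ((¬ (k ∣ x) → x + x / k ≤ n) × (k ∣ x → (x + x / k) ∸ 1 ≤ n))
lemma2p1 n x k _ k≤x x≤n =
  subst (λ n → FPositive n x k ⇔ ((¬ (k ∣ x) → x + x / k ≤ n) × (k ∣ x → (x + x / k) ∸ 1 ≤ n)))
        (m+[n∸m]≡n x≤n)
        (⇔-trans (capacity x m k k≤x)
                 (case-equivalence (k ∣? x) (capacity-nondivisible x m k) (capacity-divisible x m k)))
  where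
  m : ℕ
  m = n ∸ x
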